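{- For every integer $n\geq 3$, the prism graph $P_2\square C_n$ is total prime.
   Context: All graphs are finite and simple. For a graph $G$ with vertex set $V$ and edge set $E$, a total prime labeling is a bijection $\ell: V\cup E\to\{1,2,\ldots,|V|+|E|\}$ such that (i) for every pair of adjacent vertices $u,v$, $\gcd(\ell(u),\ell(v))=1$, and (ii) for every vertex $v$ of degree at least 2, the greatest common divisor of the labels $\ell(uv)$ over all edges $uv$ incident to $v$ equals 1. A graph is total prime if it admits a total prime labeling. $P_2\square C_n$ is the Cartesian product of the path on 2 vertices and the cycle on $n$ vertices: two $n$-cycles $u_1\ldots u_n$ and $v_1\ldots v_n$ together with the edges $u_iv_i$. -}

module Defs where

open import Data.Nat using (ℕ; suc; _+_; _≤_; NonZero)
open import Data.Nat.DivMod using (_mod_)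
open import Data.Nat.GCD using (gcd)
open import Data.Nat.Coprimality using (Coprime)
open import Data.Fin using (Fin; toℕ; _↑ˡ_; _↑ʳ_; _≟_)
open import Data.List using (List; []; _∷_; length; map; filter; foldr; allFin; lookup; concatMap)
open import Data.Product using (_×_; _,_; proj₁; proj₂; ∃)
open import Data.Sum using (_⊎_; inj₁; inj₂)
open import Relation.Binary.PropositionalEquality using (_≡_)
open import Relation.Nullary.Decidable using (_⊎-dec_)
open import Function.Definitions using (Bijective)

record Graph : Set where
  field
    nV    : ℕ
    edges : List (Fin nV × Fin nV)
open Graph public

nE : Graph → ℕ
nE G = length (edges G)

Edge : Graph → Set
Edge G = Fin (nE G)

ends : (G : Graph) → Edge G → Fin (nV G) × Fin (nV G)
ends G e = lookup (edges G) e

Adjacent : (G : Graph) → Fin (nV G) → Fin (nV G) → Set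
Adjacent G u v = ∃ λ (e : Edge G) → ends G e ≡ (u , v) ⊎ ends G e ≡ (v , u)

incident : (G : Graph) → Fin (nV G) → List (Edge G)
incident G v = filter (λ e → (proj₁ (ends G e) ≟ v) ⊎-dec (proj₂ (ends G e) ≟ v)) (allFin (nE G))

degree : (G : Graph) → Fin (nV G) → ℕ
degree G v = length (incident G v)

gcdList : List ℕ → ℕ
gcdList = foldr gcd 0

-- A total prime labeling: a bijection ℓ : V ∪ E → {1,…,|V|+|E|}
-- (encoded as a bijection onto Fin (|V|+|E|), label = 1 + index).
record TotalPrimeLabeling (G : Graph) : Set where
  field
    ℓ         : Fin (nV G) ⊎ Edge G → Fin (nV G + nE G)
    bijective : Bijective _≡_ _≡_ ℓ
  label : Fin (nV G) ⊎ Edge G → ℕ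
  label x = suc (toℕ (ℓ x))
  field
    adjCoprime : ∀ u v → Adjacent G u v → Coprime (label (inj₁ u)) (label (inj₁ v))
    edgeGcd    : ∀ v → 2 ≤ degree G v →
                 gcdList (map (λ e → label (inj₂ e)) (incident G v)) ≡ 1

TotalPrime : Graph → Set
TotalPrime G = TotalPrimeLabeling G

-- The prism P₂ □ Cₙ (n ≥ 1 for the construction; n ≥ 3 for simplicity).
-- Vertices u_i = i ↑ˡ n, v_i = n ↑ʳ i (i : Fin n); edges u_i u_{i+1},
-- v_i v_{i+1}, u_i v_i (indices mod n).
prism : (n : ℕ) .{{_ : NonZero n}} → Graph
prism n = record
  { nV = n + n
  ; edges = concatMap
      (λ i → let j = suc (toℕ i) mod n in
        (i ↑ˡ n , j ↑ˡ n) ∷ (n ↑ʳ i , n ↑ʳ j) ∷ (i ↑ˡ n , n ↑ʳ i) ∷ [])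
      (allFin n)
  }

-- Cut the prism into n blocks, block i consisting of u_i, v_i and the edges u_iu_{i+1},
-- v_iv_{i+1}, u_iv_i, and give block i the labels 5i+1, …, 5i+5, in the order
-- u_i, v_i, u_iu_{i+1}, u_iv_i, v_iv_{i+1} for i ≥ 1 and u_0, u_0u_1, u_0v_0, v_0v_1, v_0 for
-- i = 0.  Then u_i, v_i are consecutive (or 1 and 5); neighbours along a cycle differ by 5
-- and are prime to 5, except at the wrap-around, where they meet u_0 = 1 and v_0 = 5; and
-- each vertex lies on two edges with consecutive labels.  Block 0 is special because
-- v_0 = 2 would share the factor 2 with v_{n-1} = 5n - 3 for odd n.
module Submission where

open import Defs
open import Data.Nat using (ℕ; zero; suc; _+_; _*_; _≤_; _<_; _<?_; NonZero; s≤s; s≤s⁻¹; z≤n)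
open import Data.Nat.Properties using (+-comm; *-comm; ≤-antisym; ≮⇒≥; ≤-trans)
open import Data.Nat.DivMod using (_mod_; _%_; m<n⇒m%n≡m; n%n≡0)
open import Data.Nat.Divisibility using (_∣_; ∣m+n∣m⇒∣n; ∣n⇒∣m*n; ∣-trans)
open import Data.Nat.GCD using (gcd[m,n]∣m; gcd[m,n]∣n)
open import Data.Nat.Coprimality using (Coprime; 1-coprimeTo; coprime-+; coprime?) renaming (sym to coprime-sym)
open import Data.Nat.Tactic.RingSolver using (solve-∀)
open import Data.Fin using (Fin; zero; suc; toℕ; _↑ˡ_; _↑ʳ_; splitAt; combine; cast; _≟_)
open import Data.Fin.Patterns using (0F; 1F; 2F; 3F; 4F)
open import Data.Fin.Properties using (splitAt-↑ˡ; splitAt-↑ʳ; splitAt⁻¹-↑ˡ; splitAt⁻¹-↑ʳ; toℕ-combine; toℕ-cast; cast-involutive; toℕ-fromℕ<; toℕ<n; *↔×)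
open import Data.List using (List; _∷_; length; map; lookup; concatMap; tabulate)
open import Data.List.Membership.Propositional using (_∈_)
open import Data.List.Membership.Propositional.Properties using (∈-filter⁺; ∈-map⁺; ∈-allFin)
open import Data.List.Relation.Unary.Any using (here; there)
open import Data.Product using (_×_; _,_; proj₁; proj₂; map₁; map₂; uncurry)
open import Data.Sum using (_⊎_; inj₁; inj₂; [_,_])
open import Function using (id; _∘_; _↔_; Inverse; Bijection; mk↔ₛ′)
open import Function.Properties.Inverse using (↔-trans; ↔-sym; Inverse⇒Bijection)
open import Relation.Binary using (Symmetric)
open import Relation.Binary.PropositionalEquality using (_≡_; refl; sym; trans; cong; subst; subst₂; module ≡-Reasoning)
open import Relation.Nullary using (yes; no)
open import Relation.Nullary.Decidable using (from-yes; _⊎-dec_)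

coprime[m,n]⇒coprime[n,m+n] : ∀ {m n} → Coprime m n → Coprime n (m + n)
coprime[m,n]⇒coprime[n,m+n] {m} {n} c = subst (Coprime n) (+-comm n m) (coprime-sym (coprime-+ c))

coprime[m,n]⇒coprime[m,n+km] : ∀ {m n} k → Coprime m n → Coprime m (n + k * m)
coprime[m,n]⇒coprime[m,n+km] {m} {n} k c {d} (d∣m , d∣n+km) =
  c (d∣m , ∣m+n∣m⇒∣n (subst (d ∣_) (+-comm n (k * m)) d∣n+km) (∣n⇒∣m*n k d∣m))

coprime[n,1+n] : ∀ n → Coprime n (suc n)
coprime[n,1+n] n = coprime[m,n]⇒coprime[n,m+n] (1-coprimeTo n)

gcdList-∣ : ∀ {x xs} → x ∈ xs → gcdList xs ∣ x
gcdList-∣ {xs = x ∷ xs} (here refl)   = gcd[m,n]∣m x (gcdList xs)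
gcdList-∣ {xs = y ∷ xs} (there x∈xs) = ∣-trans (gcd[m,n]∣n y (gcdList xs)) (gcdList-∣ x∈xs)

coprime∧∈⇒gcdList≡1 : ∀ {x y xs} → x ∈ xs → y ∈ xs → Coprime x y → gcdList xs ≡ 1
coprime∧∈⇒gcdList≡1 x∈xs y∈xs c = c (gcdList-∣ x∈xs , gcdList-∣ y∈xs)

toℕ-[1+i]mod : ∀ {n} .{{_ : NonZero n}} (i : Fin n) →
               toℕ (suc (toℕ i) mod n) ≡ suc (toℕ i) ⊎
               suc (toℕ i) ≡ n × toℕ (suc (toℕ i) mod n) ≡ 0
toℕ-[1+i]mod {n} i with suc (toℕ i) <? n
... | yes 1+i<n = inj₁ (trans (toℕ-fromℕ< _) (m<n⇒m%n≡m 1+i<n))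
... | no 1+i≮n  = inj₂ (1+i≡n , trans (toℕ-fromℕ< _) (trans (cong (_% n) 1+i≡n) (n%n≡0 n)))
  where
  1+i≡n : suc (toℕ i) ≡ n
  1+i≡n = ≤-antisym (toℕ<n i) (≮⇒≥ 1+i≮n)

cast↔ : ∀ {a b} → a ≡ b → Fin a ↔ Fin b
cast↔ eq = mk↔ₛ′ (cast eq) (cast (sym eq)) (cast-involutive eq (sym eq)) (cast-involutive (sym eq) eq)

module _ (G : Graph) where

  ∈-incident : ∀ {w} e → proj₁ (ends G e) ≡ w ⊎ proj₂ (ends G e) ≡ w → e ∈ incident G w
  ∈-incident {w} e = ∈-filter⁺ (λ e → (proj₁ (ends G e) ≟ w) ⊎-dec (proj₂ (ends G e) ≟ w)) (∈-allFin e)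

  ends⇒adjacent : ∀ {R : Fin (nV G) → Fin (nV G) → Set} → Symmetric R →
                  (∀ e → uncurry R (ends G e)) → ∀ u v → Adjacent G u v → R u v
  ends⇒adjacent {R} R-sym R-ends u v (e , inj₁ e≡uv) = subst (uncurry R) e≡uv (R-ends e)
  ends⇒adjacent {R} R-sym R-ends u v (e , inj₂ e≡vu) = R-sym (subst (uncurry R) e≡vu (R-ends e))

module Triples {A B : Set} (f : A → Fin 3 → B) where

  triples : ∀ {m} → (Fin m → A) → List B
  triples g = concatMap (tabulate ∘ f) (tabulate g)

  length-triples : ∀ {m} (g : Fin m → A) → length (triples g) ≡ m * 3
  length-triples {zero}  g = refl
  length-triples {suc m} g = cong (3 +_) (length-triples (g ∘ suc))

  position : ∀ {m} (g : Fin m → A) → Fin m × Fin 3 → Fin (length (triples g))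
  position {suc m} g (zero  , t) = t ↑ˡ length (triples (g ∘ suc))
  position {suc m} g (suc i , t) = 3 ↑ʳ position (g ∘ suc) (i , t)

  block : ∀ {m} (g : Fin m → A) → Fin (length (triples g)) → Fin m × Fin 3
  block {suc m} g e = [ (zero ,_) , map₁ suc ∘ block (g ∘ suc) ] (splitAt 3 e)

  block-position : ∀ {m} (g : Fin m → A) p → block g (position g p) ≡ p
  block-position {suc m} g (zero , t) rewrite splitAt-↑ˡ 3 t (length (triples (g ∘ suc))) = refl
  block-position {suc m} g (suc i , t)
    rewrite splitAt-↑ʳ 3 (length (triples (g ∘ suc))) (position (g ∘ suc) (i , t))
          | block-position (g ∘ suc) (i , t) = refl

  position-block : ∀ {m} (g : Fin m → A) e → position g (block g e) ≡ e
  position-block {suc m} g e with splitAt 3 e in eq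
  ... | inj₁ t  = splitAt⁻¹-↑ˡ eq
  ... | inj₂ e′ = trans (cong (3 ↑ʳ_) (position-block (g ∘ suc) e′)) (splitAt⁻¹-↑ʳ eq)

  lookup-position : ∀ {m} (g : Fin m → A) p → lookup (triples g) (position g p) ≡ uncurry (f ∘ g) p
  lookup-position {suc m} g (zero  , 0F) = refl
  lookup-position {suc m} g (zero  , 1F) = refl
  lookup-position {suc m} g (zero  , 2F) = refl
  lookup-position {suc m} g (suc i , t)  = lookup-position (g ∘ suc) (i , t)

  lookup-triples : ∀ {m} (g : Fin m → A) e → lookup (triples g) e ≡ uncurry (f ∘ g) (block g e)
  lookup-triples g e = trans (cong (lookup (triples g)) (sym (position-block g e)))
                             (lookup-position g (block g e))

-- (i , U), (i , V), (i , UU), (i , VV), (i , UV) stand for u_i, v_i, u_iu_{i+1}, v_iv_{i+1},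
-- u_iv_i; the edge pieces are numbered as the three edges of block i in prism.
Piece : Set
Piece = Fin 2 ⊎ Fin 3

pattern U  = inj₁ 0F
pattern V  = inj₁ 1F
pattern UU = inj₂ 0F
pattern VV = inj₂ 1F
pattern UV = inj₂ 2F

slot : ℕ → Piece → Fin 5
slot zero    U  = 0F
slot zero    UU = 1F
slot zero    UV = 2F
slot zero    VV = 3F
slot zero    V  = 4F
slot (suc _) U  = 0F
slot (suc _) V  = 1F
slot (suc _) UU = 2F
slot (suc _) UV = 3F
slot (suc _) VV = 4F

piece : ℕ → Fin 5 → Piece
piece zero    0F = U
piece zero    1F = UU
piece zero    2F = UV
piece zero    3F = VV
piece zero    4F = V
piece (suc _) 0F = U
piece (suc _) 1F = V
piece (suc _) 2F = UU
piece (suc _) 3F = UV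
piece (suc _) 4F = VV

slot-piece : ∀ k s → slot k (piece k s) ≡ s
slot-piece zero    = λ { 0F → refl ; 1F → refl ; 2F → refl ; 3F → refl ; 4F → refl }
slot-piece (suc _) = λ { 0F → refl ; 1F → refl ; 2F → refl ; 3F → refl ; 4F → refl }

piece-slot : ∀ k c → piece k (slot k c) ≡ c
piece-slot zero    = λ { U → refl ; V → refl ; UU → refl ; VV → refl ; UV → refl }
piece-slot (suc _) = λ { U → refl ; V → refl ; UU → refl ; VV → refl ; UV → refl }

blockLabel : ℕ → Piece → ℕ
blockLabel k c = suc (toℕ (slot k c)) + k * 5

coprime-U-V : ∀ k → Coprime (blockLabel k U) (blockLabel k V)
coprime-U-V zero    = 1-coprimeTo 5
coprime-U-V (suc k) = coprime[n,1+n] _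

coprime-UU-UV : ∀ k → Coprime (blockLabel k UU) (blockLabel k UV)
coprime-UU-UV zero    = coprime[n,1+n] 2
coprime-UU-UV (suc k) = coprime[n,1+n] _

coprime-UV-VV : ∀ k → Coprime (blockLabel k UV) (blockLabel k VV)
coprime-UV-VV zero    = coprime[n,1+n] 3
coprime-UV-VV (suc k) = coprime[n,1+n] _

coprime-5-rim : ∀ s k → Coprime 5 (blockLabel (suc k) (inj₁ s))
coprime-5-rim 0F k = coprime[m,n]⇒coprime[m,n+km] (suc k) (coprime-sym (1-coprimeTo 5))
coprime-5-rim 1F k = coprime[m,n]⇒coprime[m,n+km] (suc k) (from-yes (coprime? 5 2))

coprime-rim-suc : ∀ s k → Coprime (blockLabel k (inj₁ s)) (blockLabel (suc k) (inj₁ s))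
coprime-rim-suc 0F zero    = 1-coprimeTo _
coprime-rim-suc 1F zero    = coprime-5-rim 1F 0
coprime-rim-suc 0F (suc k) = coprime[m,n]⇒coprime[n,m+n] (coprime-5-rim 0F k)
coprime-rim-suc 1F (suc k) = coprime[m,n]⇒coprime[n,m+n] (coprime-5-rim 1F k)

coprime-rim-zero : ∀ s {k} → 0 < k → Coprime (blockLabel k (inj₁ s)) (blockLabel 0 (inj₁ s))
coprime-rim-zero 0F         _ = coprime-sym (1-coprimeTo _)
coprime-rim-zero 1F {suc k} _ = coprime-sym (coprime-5-rim 1F k)

module Prism (n : ℕ) .{{_ : NonZero n}} where

  G : Graph
  G = prism n

  next : Fin n → Fin n
  next i = suc (toℕ i) mod n

  prismEdge : Fin n → Fin 3 → Fin (n + n) × Fin (n + n)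
  prismEdge i 0F = i ↑ˡ n , next i ↑ˡ n
  prismEdge i 1F = n ↑ʳ i , n ↑ʳ next i
  prismEdge i 2F = i ↑ˡ n , n ↑ʳ i

  open Triples prismEdge

  element : Fin n × Piece → Fin (nV G) ⊎ Edge G
  element (i , U)      = inj₁ (i ↑ˡ n)
  element (i , V)      = inj₁ (n ↑ʳ i)
  element (i , inj₂ t) = inj₂ (position id (i , t))

  cell : Fin (nV G) ⊎ Edge G → Fin n × Piece
  cell (inj₁ w) = [ (_, U) , (_, V) ] (splitAt n w)
  cell (inj₂ e) = map₂ inj₂ (block id e)

  cell-element : ∀ p → cell (element p) ≡ p
  cell-element (i , U)      = cong [ (_, U) , (_, V) ] (splitAt-↑ˡ n i n)
  cell-element (i , V)      = cong [ (_, U) , (_, V) ] (splitAt-↑ʳ n n i)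
  cell-element (i , inj₂ t) = cong (map₂ inj₂) (block-position id (i , t))

  element-cell : ∀ x → element (cell x) ≡ x
  element-cell (inj₁ w) with splitAt n w in eq
  ... | inj₁ i = cong inj₁ (splitAt⁻¹-↑ˡ eq)
  ... | inj₂ i = cong inj₁ (splitAt⁻¹-↑ʳ eq)
  element-cell (inj₂ e) = cong inj₂ (position-block id e)

  slotted : (Fin n × Piece) ↔ (Fin n × Fin 5)
  slotted = mk↔ₛ′ (λ (i , c) → i , slot (toℕ i) c) (λ (i , s) → i , piece (toℕ i) s)
                  (λ (i , s) → cong (i ,_) (slot-piece (toℕ i) s))
                  (λ (i , c) → cong (i ,_) (piece-slot (toℕ i) c))

  size : n * 5 ≡ nV G + nE G
  size = trans (n*5≡n+n+n*3 n) (cong (n + n +_) (sym (length-triples id)))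
    where
    n*5≡n+n+n*3 : ∀ n → n * 5 ≡ n + n + n * 3
    n*5≡n+n+n*3 = solve-∀

  positions : (Fin n × Piece) ↔ Fin (nV G + nE G)
  positions = ↔-trans slotted (↔-trans (↔-sym *↔×) (cast↔ size))

  labelling : (Fin (nV G) ⊎ Edge G) ↔ Fin (nV G + nE G)
  labelling = ↔-trans (mk↔ₛ′ cell element cell-element element-cell) positions

  label : Fin (nV G) ⊎ Edge G → ℕ
  label x = suc (toℕ (Inverse.to labelling x))

  label-element : ∀ i c → label (element (i , c)) ≡ blockLabel (toℕ i) c
  label-element i c = begin
    label (element (i , c))                 ≡⟨ cong (suc ∘ toℕ ∘ Inverse.to positions) (cell-element (i , c)) ⟩
    suc (toℕ (cast size (combine i s)))     ≡⟨ cong suc (toℕ-cast size (combine i s)) ⟩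
    suc (toℕ (combine i s))                 ≡⟨ cong suc (toℕ-combine i s) ⟩
    suc (5 * toℕ i + toℕ s)                 ≡⟨ cong suc (+-comm (5 * toℕ i) (toℕ s)) ⟩
    suc (toℕ s + 5 * toℕ i)                 ≡⟨ cong (λ m → suc (toℕ s + m)) (*-comm 5 (toℕ i)) ⟩
    blockLabel (toℕ i) c                    ∎
    where
    open ≡-Reasoning
    s = slot (toℕ i) c

  coprime-rim-cyclic : 1 < n → ∀ s i →
                       Coprime (blockLabel (toℕ i) (inj₁ s)) (blockLabel (toℕ (next i)) (inj₁ s))
  coprime-rim-cyclic 1<n s i with toℕ-[1+i]mod i
  ... | inj₁ next≡1+i rewrite next≡1+i = coprime-rim-suc s (toℕ i)
  ... | inj₂ (1+i≡n , next≡0) rewrite next≡0 =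
    coprime-rim-zero s (s≤s⁻¹ (subst (1 <_) (sym 1+i≡n) 1<n))

  CoprimeEnds : Fin (nV G) → Fin (nV G) → Set
  CoprimeEnds a b = Coprime (label (inj₁ a)) (label (inj₁ b))

  coprime-prismEdge : 1 < n → ∀ i t → uncurry CoprimeEnds (prismEdge i t)
  coprime-prismEdge 1<n i 0F = subst₂ Coprime (sym (label-element i U)) (sym (label-element (next i) U))
                                      (coprime-rim-cyclic 1<n 0F i)
  coprime-prismEdge 1<n i 1F = subst₂ Coprime (sym (label-element i V)) (sym (label-element (next i) V))
                                      (coprime-rim-cyclic 1<n 1F i)
  coprime-prismEdge 1<n i 2F = subst₂ Coprime (sym (label-element i U)) (sym (label-element i V))
                                      (coprime-U-V (toℕ i))

  coprime-ends : 1 < n → ∀ e → uncurry CoprimeEnds (ends G e)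
  coprime-ends 1<n e = subst (uncurry CoprimeEnds) (sym (lookup-triples id e))
                             (uncurry (coprime-prismEdge 1<n) (block id e))

  edgeLabels : Fin (nV G) → List ℕ
  edgeLabels w = map (λ e → label (inj₂ e)) (incident G w)

  blockLabel-∈-edgeLabels : ∀ i t {w} → proj₁ (prismEdge i t) ≡ w ⊎ proj₂ (prismEdge i t) ≡ w →
                            blockLabel (toℕ i) (inj₂ t) ∈ edgeLabels w
  blockLabel-∈-edgeLabels i t {w} w∈e =
    subst (_∈ edgeLabels w) (label-element i (inj₂ t))
      (∈-map⁺ (λ e → label (inj₂ e))
        (∈-incident G (position id (i , t))
          (subst (λ (a , b) → a ≡ w ⊎ b ≡ w) (sym (lookup-position id (i , t))) w∈e)))

  gcd-edgeLabels : ∀ w → gcdList (edgeLabels w) ≡ 1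
  gcd-edgeLabels w with splitAt n w in eq
  ... | inj₁ i = subst (λ w → gcdList (edgeLabels w) ≡ 1) (splitAt⁻¹-↑ˡ eq)
                   (coprime∧∈⇒gcdList≡1 (blockLabel-∈-edgeLabels i 0F (inj₁ refl))
                                        (blockLabel-∈-edgeLabels i 2F (inj₁ refl))
                                        (coprime-UU-UV (toℕ i)))
  ... | inj₂ i = subst (λ w → gcdList (edgeLabels w) ≡ 1) (splitAt⁻¹-↑ʳ eq)
                   (coprime∧∈⇒gcdList≡1 (blockLabel-∈-edgeLabels i 2F (inj₂ refl))
                                        (blockLabel-∈-edgeLabels i 1F (inj₁ refl))
                                        (coprime-UV-VV (toℕ i)))

  totalPrimeLabeling : 1 < n → TotalPrimeLabeling G
  totalPrimeLabeling 1<n = record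
    { ℓ          = Inverse.to labelling
    ; bijective  = Bijection.bijective (Inverse⇒Bijection labelling)
    ; adjCoprime = ends⇒adjacent G coprime-sym (coprime-ends 1<n)
    ; edgeGcd    = λ w _ → gcd-edgeLabels w
    }

mainTheorem13 : (n : ℕ) .{{_ : NonZero n}} → 3 ≤ n → TotalPrime (prism n)
mainTheorem13 n 3≤n = Prism.totalPrimeLabeling n (≤-trans (s≤s (s≤s z≤n)) 3≤n)
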